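{- Let $N = q^k n^2$ be an odd perfect number given in Eulerian form. Define $H = \gcd(n^2,\sigma(n^2))$, $I = \gcd(n,\sigma(n^2))$ and $J = H/I$. Then $$J = \frac{n}{\gcd\big(\sigma(q^k)/2,\, n\big)}.$$
   Context: $\sigma(x)$ denotes the sum of the positive divisors of $x$. A positive integer $N$ is perfect if $\sigma(N)=2N$. An odd perfect number $N$ is said to be given in Eulerian form $N = q^k n^2$ if $q$ is a prime (the special prime), $k$ and $n$ are positive integers, $q \equiv k \equiv 1 \pmod 4$, and $\gcd(q,n)=1$. (For such $N$, $\sigma(q^k)$ is even and $I$ divides $H$, so $J$ is a positive integer; also $J = I/G$ where $G=\gcd(\sigma(q^k),\sigma(n^2))$.) -}

module Defs where

open import Data.Nat using (ℕ; suc)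
open import Data.List using (upTo; map; filter)
open import Data.Nat.ListAction using (sum)
open import Data.Nat.Divisibility using (_∣?_)

σ : ℕ → ℕ
σ x = sum (filter (_∣? x) (map suc (upTo x)))

-- Writing N = qᵏ n², multiplicativity gives σ(qᵏ) σ(n²) = 2 qᵏ n². Since q ≡ k ≡ 1 (mod 4),
-- σ(qᵏ) = 1 + q + ⋯ + qᵏ is even, say σ(qᵏ) = 2w, and it is coprime to qᵏ, so qᵏ divides
-- σ(n²): σ(n²) = c qᵏ with n² = w c. As n is coprime to q, H = gcd(n², c qᵏ) = c and
-- I = gcd(n, c), and c · gcd(w, n) = gcd(n², n c) = n · gcd(n, c) gives H / I = n / gcd(w, n).
module Submission where

open import Defs
open import Data.Bool using (true; false; if_then_else_)
open import Data.List using (List; []; _∷_; upTo; map; filter; _++_; [_])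
open import Data.List.Properties using (upTo-∷ʳ; map-++)
open import Data.Nat
open import Data.Nat.Coprimality using (Coprime; coprime-divisor; gcd≡1⇒coprime)
  renaming (sym to coprime-sym)
open import Data.Nat.Divisibility
open import Data.Nat.DivMod using (m≡m%n+[m/n]*n; m/n*n≡m; m*[n/m]≡n; /-congˡ; /-congʳ)
open import Data.Nat.GCD
open import Data.Nat.ListAction using (sum)
open import Data.Nat.ListAction.Properties using (sum-++)
open import Data.Nat.Primality using (Prime; prime⇒irreducible; prime⇒nonZero; prime⇒nonTrivial)
open import Data.Nat.Properties
open import Algebra.Properties.CommutativeSemigroup +-commutativeSemigroup using (interchange)
open import Data.Nat.Tactic.RingSolver using (solve-∀)
open import Data.Product using (∃-syntax; _×_; _,_)
open import Data.Sum using (inj₁; inj₂)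
open import Function using (id)
open import Level using (Level)
open import Relation.Binary.PropositionalEquality hiding ([_])
open import Relation.Nullary using (¬_; Dec; yes; no; does; contradiction)
open import Relation.Unary using (Pred; Decidable)
open import Relation.Unary.Properties using (∁?)

private
  variable
    ℓ : Level
    P : Pred ℕ ℓ

∑ : (ℕ → ℕ) → ℕ → ℕ
∑ h zero    = 0
∑ h (suc n) = ∑ h n + h (suc n)

∑-cong : ∀ {f g} n → (∀ d → 0 < d → d ≤ n → f d ≡ g d) → ∑ f n ≡ ∑ g n
∑-cong zero    f≗g = refl
∑-cong (suc n) f≗g =
  cong₂ _+_ (∑-cong n λ d 0<d d≤n → f≗g d 0<d (m≤n⇒m≤1+n d≤n)) (f≗g (suc n) z<s ≤-refl)

∑-vanishing : ∀ {h} n → (∀ d → 0 < d → d ≤ n → h d ≡ 0) → ∑ h n ≡ 0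
∑-vanishing zero    h≗0 = refl
∑-vanishing (suc n) h≗0 =
  cong₂ _+_ (∑-vanishing n λ d 0<d d≤n → h≗0 d 0<d (m≤n⇒m≤1+n d≤n)) (h≗0 (suc n) z<s ≤-refl)

∑-+ : ∀ f g n → ∑ (λ d → f d + g d) n ≡ ∑ f n + ∑ g n
∑-+ f g zero    = refl
∑-+ f g (suc n) = trans (cong (_+ (f (suc n) + g (suc n))) (∑-+ f g n))
                       (interchange (∑ f n) (∑ g n) (f (suc n)) (g (suc n)))

∑-*ˡ : ∀ a h n → ∑ (λ d → a * h d) n ≡ a * ∑ h n
∑-*ˡ a h zero    = sym (*-zeroʳ a)
∑-*ˡ a h (suc n) = trans (cong (_+ a * h (suc n)) (∑-*ˡ a h n)) (sym (*-distribˡ-+ a (∑ h n) (h (suc n))))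

∑-+-range : ∀ h m n → ∑ h (m + n) ≡ ∑ h m + ∑ (λ d → h (m + d)) n
∑-+-range h m zero    = trans (cong (∑ h) (+-identityʳ m)) (sym (+-identityʳ _))
∑-+-range h m (suc n) = begin
  ∑ h (m + suc n)                                ≡⟨ cong (∑ h) (+-suc m n) ⟩
  ∑ h (m + n) + h (suc (m + n))                  ≡⟨ cong₂ _+_ (∑-+-range h m n) (cong h (sym (+-suc m n))) ⟩
  ∑ h m + ∑ (λ d → h (m + d)) n + h (m + suc n)  ≡⟨ +-assoc (∑ h m) _ _ ⟩
  ∑ h m + ∑ (λ d → h (m + d)) (suc n)            ∎
  where open ≡-Reasoning

∑-extend : ∀ {h m b} → m ≤ b → (∀ d → m < d → h d ≡ 0) → ∑ h b ≡ ∑ h m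
∑-extend {h} {m} m≤b h≗0 = go (≤⇒≤′ m≤b)
  where
  go : ∀ {b} → m ≤′ b → ∑ h b ≡ ∑ h m
  go ≤′-refl          = refl
  go (≤′-step {b} m≤b) = trans (cong₂ _+_ (go m≤b) (h≗0 (suc b) (s≤s (≤′⇒≤ m≤b)))) (+-identityʳ _)

sum-map-suc-upTo : ∀ h n → sum (map h (map suc (upTo n))) ≡ ∑ h n
sum-map-suc-upTo h zero    = refl
sum-map-suc-upTo h (suc n) = begin
  sum (map h (map suc (upTo (suc n))))
    ≡⟨ cong (λ l → sum (map h (map suc l))) (sym (upTo-∷ʳ n)) ⟩
  sum (map h (map suc (upTo n ++ [ n ])))
    ≡⟨ cong (λ l → sum (map h l)) (map-++ suc (upTo n) [ n ]) ⟩
  sum (map h (map suc (upTo n) ++ [ suc n ]))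
    ≡⟨ cong sum (map-++ h (map suc (upTo n)) [ suc n ]) ⟩
  sum (map h (map suc (upTo n)) ++ [ h (suc n) ])
    ≡⟨ sum-++ (map h (map suc (upTo n))) [ h (suc n) ] ⟩
  sum (map h (map suc (upTo n))) + (h (suc n) + 0)
    ≡⟨ cong₂ _+_ (sum-map-suc-upTo h n) (+-identityʳ _) ⟩
  ∑ h (suc n)
    ∎
  where open ≡-Reasoning

restrict : Decidable P → (ℕ → ℕ) → ℕ → ℕ
restrict P? h d = if does (P? d) then h d else 0

module _ (P? : Decidable P) (h : ℕ → ℕ) {d : ℕ} where

  restrict-∈ : P d → restrict P? h d ≡ h d
  restrict-∈ p with P? d
  ... | yes _ = refl
  ... | no ¬p = contradiction p ¬p

  restrict-∉ : ¬ P d → restrict P? h d ≡ 0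
  restrict-∉ ¬p with P? d
  ... | yes p = contradiction p ¬p
  ... | no _  = refl

  restrict-split : h d ≡ restrict P? h d + restrict (∁? P?) h d
  restrict-split with does (P? d)
  ... | true  = sym (+-identityʳ (h d))
  ... | false = refl

sum-filter : (P? : Decidable P) (xs : List ℕ) → sum (filter P? xs) ≡ sum (map (restrict P? id) xs)
sum-filter P? []       = refl
sum-filter P? (x ∷ xs) with P? x
... | yes _ = cong (x +_) (sum-filter P? xs)
... | no _  = sum-filter P? xs

divisorTerm : ℕ → ℕ → ℕ
divisorTerm x = restrict (_∣? x) id

module _ {x d : ℕ} where

  divisorTerm-∣ : d ∣ x → divisorTerm x d ≡ d
  divisorTerm-∣ = restrict-∈ (_∣? x) id

  divisorTerm-∤ : ¬ d ∣ x → divisorTerm x d ≡ 0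
  divisorTerm-∤ = restrict-∉ (_∣? x) id

  divisorTerm-> : .{{_ : NonZero x}} → x < d → divisorTerm x d ≡ 0
  divisorTerm-> x<d = divisorTerm-∤ λ d∣x → <⇒≱ x<d (∣⇒≤ d∣x)

divisorTerm-*ˡ : ∀ a {x} d .{{_ : NonZero a}} → divisorTerm (a * x) (a * d) ≡ a * divisorTerm x d
divisorTerm-*ˡ a {x} d with d ∣? x
... | yes d∣x = divisorTerm-∣ (*-monoʳ-∣ a d∣x)
... | no d∤x  = trans (divisorTerm-∤ λ ad∣ax → d∤x (*-cancelˡ-∣ a ad∣ax)) (sym (*-zeroʳ a))

σ≡∑ : ∀ x → σ x ≡ ∑ (divisorTerm x) x
σ≡∑ x = trans (sum-filter (_∣? x) (map suc (upTo x))) (sum-map-suc-upTo (divisorTerm x) x)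

σ≡∑-≥ : ∀ {x b} .{{_ : NonZero x}} → x ≤ b → σ x ≡ ∑ (divisorTerm x) b
σ≡∑-≥ {x} x≤b = trans (σ≡∑ x) (sym (∑-extend x≤b λ _ → divisorTerm->))

∑-multiples : ∀ p .{{_ : NonZero p}} h M → ∑ (restrict (p ∣?_) h) (p * M) ≡ ∑ (λ e → h (p * e)) M
∑-multiples p h zero = cong (∑ _) (*-zeroʳ p)
∑-multiples p@(suc p′) h (suc M) = begin
  ∑ h′ (p * suc M)
    ≡⟨ cong (∑ h′) (trans (*-suc p M) (+-comm p (p * M))) ⟩
  ∑ h′ (p * M + p)
    ≡⟨ ∑-+-range h′ (p * M) p ⟩
  ∑ h′ (p * M) + (∑ (λ d → h′ (p * M + d)) p′ + h′ (p * M + p))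
    ≡⟨ cong₂ (λ a b → a + (b + h′ (p * M + p))) (∑-multiples p h M) (∑-vanishing p′ non-multiples) ⟩
  ∑ (λ e → h (p * e)) M + (0 + h′ (p * M + p))
    ≡⟨ cong (∑ (λ e → h (p * e)) M +_) last-multiple ⟩
  ∑ (λ e → h (p * e)) (suc M)
    ∎
  where
  open ≡-Reasoning
  h′ : ℕ → ℕ
  h′ = restrict (p ∣?_) h
  non-multiples : ∀ d → 0 < d → d ≤ p′ → h′ (p * M + d) ≡ 0
  non-multiples d 0<d d<p = restrict-∉ (p ∣?_) h λ p∣pM+d →
    <⇒≱ (s≤s d<p) (∣⇒≤ {{>-nonZero 0<d}} (∣m+n∣m⇒∣n p∣pM+d (m∣m*n M)))
  last-multiple : h′ (p * M + p) ≡ h (p * suc M)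
  last-multiple = trans (restrict-∈ (p ∣?_) h (∣m∣n⇒∣m+n (m∣m*n M) ∣-refl))
                        (cong h (trans (+-comm (p * M) p) (sym (*-suc p M))))

coprime-∣-pow-* : ∀ {d p m} j → Coprime d p → d ∣ p ^ j * m → d ∣ m
coprime-∣-pow-* {d} {p} {m} zero    d⊥p d∣m = subst (d ∣_) (*-identityˡ m) d∣m
coprime-∣-pow-* {d} {p} {m} (suc j) d⊥p d∣pʲ⁺¹m =
  coprime-∣-pow-* j d⊥p (coprime-divisor d⊥p (subst (d ∣_) (*-assoc p (p ^ j) m) d∣pʲ⁺¹m))

coprime-pow : ∀ {m n} j → Coprime m n → Coprime (m ^ j) n
coprime-pow {m} j m⊥n {d} (d∣mʲ , d∣n) =
  ∣1⇒≡1 (coprime-∣-pow-* j d⊥m (subst (d ∣_) (sym (*-identityʳ (m ^ j))) d∣mʲ))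
  where
  d⊥m : Coprime d m
  d⊥m (e∣d , e∣m) = m⊥n (e∣m , ∣-trans e∣d d∣n)

∤⇒coprime : ∀ {p d} → Prime p → ¬ p ∣ d → Coprime d p
∤⇒coprime p-prime p∤d (e∣d , e∣p) with prime⇒irreducible p-prime e∣p
... | inj₁ e≡1 = e≡1
... | inj₂ refl = contradiction e∣d p∤d

divisorTerm-coprime : ∀ {d p m} j → Coprime d p → divisorTerm (p ^ j * m) d ≡ divisorTerm m d
divisorTerm-coprime {d} {p} {m} j d⊥p with d ∣? m
... | yes d∣m = divisorTerm-∣ (∣n⇒∣m*n (p ^ j) d∣m)
... | no d∤m  = divisorTerm-∤ λ d∣pʲm → d∤m (coprime-∣-pow-* j d⊥p d∣pʲm)

n%4≡1⇒n≡1+2*t : ∀ n → n % 4 ≡ 1 → ∃[ t ] n ≡ 1 + 2 * t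
n%4≡1⇒n≡1+2*t n n%4≡1 =
  2 * (n / 4) , trans (m≡m%n+[m/n]*n n 4) (cong₂ _+_ n%4≡1 (trans (*-comm (n / 4) 4) (*-assoc 2 2 (n / 4))))

module _ {p : ℕ} (p-prime : Prime p) where

  private
    instance
      p≢0 : NonZero p
      p≢0 = prime⇒nonZero p-prime
    p∤1 : ¬ p ∣ 1
    p∤1 p∣1 = nonTrivial⇒≢1 {{prime⇒nonTrivial p-prime}} (∣1⇒≡1 p∣1)

  -- Divisors of p · pʲm divisible by p are the p · e with e ∣ pʲm; the others are coprime
  -- to pʲ⁺¹, hence exactly the divisors of m.
  σ-p* : ∀ {m} → ¬ p ∣ m → ∀ j → σ (p * (p ^ j * m)) ≡ p * σ (p ^ j * m) + σ m
  σ-p* {m} p∤m j = begin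
    σ x                                   ≡⟨ σ≡∑ x ⟩
    ∑ (divisorTerm x) x                   ≡⟨ ∑-cong x (λ d _ _ → restrict-split (p ∣?_) (divisorTerm x)) ⟩
    ∑ (λ d → multiples d + others d) x    ≡⟨ ∑-+ multiples others x ⟩
    ∑ multiples x + ∑ others x            ≡⟨ cong₂ _+_ multiples-sum others-sum ⟩
    p * σ Q + σ m                         ∎
    where
    open ≡-Reasoning
    instance
      m≢0 : NonZero m
      m≢0 = ≢-nonZero λ { refl → p∤m (p ∣0) }
    Q x : ℕ
    Q = p ^ j * m
    x = p * Q
    instance
      Q≢0 : NonZero Q
      Q≢0 = m*n≢0 (p ^ j) m {{m^n≢0 p j}}
      x≢0 : NonZero x
      x≢0 = m*n≢0 p Q
    multiples others : ℕ → ℕ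
    multiples = restrict (p ∣?_) (divisorTerm x)
    others    = restrict (∁? (p ∣?_)) (divisorTerm x)

    multiples-sum : ∑ multiples x ≡ p * σ Q
    multiples-sum = begin
      ∑ multiples x                        ≡⟨ ∑-multiples p (divisorTerm x) Q ⟩
      ∑ (λ e → divisorTerm x (p * e)) Q    ≡⟨ ∑-cong Q (λ e _ _ → divisorTerm-*ˡ p e) ⟩
      ∑ (λ e → p * divisorTerm Q e) Q      ≡⟨ ∑-*ˡ p (divisorTerm Q) Q ⟩
      p * ∑ (divisorTerm Q) Q              ≡⟨ cong (p *_) (σ≡∑ Q) ⟨
      p * σ Q                              ∎

    others≗divisorTerm : ∀ d → Dec (p ∣ d) → others d ≡ divisorTerm m d
    others≗divisorTerm d (yes p∣d) = trans (restrict-∉ (∁? (p ∣?_)) (divisorTerm x) λ p∤d → p∤d p∣d)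
                                          (sym (divisorTerm-∤ λ d∣m → p∤m (∣-trans p∣d d∣m)))
    others≗divisorTerm d (no p∤d)  = begin
      others d                        ≡⟨ restrict-∈ (∁? (p ∣?_)) (divisorTerm x) p∤d ⟩
      divisorTerm x d                 ≡⟨ cong (λ y → divisorTerm y d) (*-assoc p (p ^ j) m) ⟨
      divisorTerm (p ^ suc j * m) d   ≡⟨ divisorTerm-coprime (suc j) (∤⇒coprime p-prime p∤d) ⟩
      divisorTerm m d                 ∎

    others-sum : ∑ others x ≡ σ m
    others-sum = trans (∑-cong x λ d _ _ → others≗divisorTerm d (p ∣? d))
                       (sym (σ≡∑-≥ (∣⇒≤ (∣n⇒∣m*n p (∣n⇒∣m*n (p ^ j) ∣-refl)))))

  σ-pow-suc : ∀ j → σ (p ^ suc j) ≡ p * σ (p ^ j) + 1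
  σ-pow-suc j = begin
    σ (p * p ^ j)            ≡⟨ cong (λ y → σ (p * y)) (*-identityʳ (p ^ j)) ⟨
    σ (p * (p ^ j * 1))      ≡⟨ σ-p* p∤1 j ⟩
    p * σ (p ^ j * 1) + σ 1  ≡⟨ cong (λ y → p * σ y + 1) (*-identityʳ (p ^ j)) ⟩
    p * σ (p ^ j) + 1        ∎
    where open ≡-Reasoning

  σ-pow-* : ∀ {m} → ¬ p ∣ m → ∀ j → σ (p ^ j * m) ≡ σ (p ^ j) * σ m
  σ-pow-* {m} p∤m zero    = trans (cong σ (*-identityˡ m)) (sym (*-identityˡ (σ m)))
  σ-pow-* {m} p∤m (suc j) = begin
    σ (p * p ^ j * m)              ≡⟨ cong σ (*-assoc p (p ^ j) m) ⟩
    σ (p * (p ^ j * m))            ≡⟨ σ-p* p∤m j ⟩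
    p * σ (p ^ j * m) + σ m        ≡⟨ cong (λ y → p * y + σ m) (σ-pow-* p∤m j) ⟩
    p * (σ (p ^ j) * σ m) + σ m    ≡⟨ cong₂ _+_ (*-assoc p (σ (p ^ j)) (σ m)) (*-identityˡ (σ m)) ⟨
    p * σ (p ^ j) * σ m + 1 * σ m  ≡⟨ *-distribʳ-+ (σ m) (p * σ (p ^ j)) 1 ⟨
    (p * σ (p ^ j) + 1) * σ m      ≡⟨ cong (_* σ m) (σ-pow-suc j) ⟨
    σ (p ^ suc j) * σ m            ∎
    where open ≡-Reasoning

  coprime-σ-pow : ∀ j → Coprime (p ^ j) (σ (p ^ j))
  coprime-σ-pow j = coprime-pow j (p⊥σ j)
    where
    p⊥σ : ∀ i → Coprime p (σ (p ^ i))
    p⊥σ zero    (_ , d∣1)   = ∣1⇒≡1 d∣1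
    p⊥σ (suc i) (d∣p , d∣σ) =
      ∣1⇒≡1 (∣m+n∣m⇒∣n (subst (_ ∣_) (σ-pow-suc i) d∣σ) (∣m⇒∣m*n (σ (p ^ i)) d∣p))

  σ-odd-pow-even : 2 ∣ 1 + p → ∀ t → 2 ∣ σ (p ^ (1 + 2 * t))
  σ-odd-pow-even 2∣1+p zero    = subst (2 ∣_) 1+p≡σ[p] 2∣1+p
    where
    1+p≡σ[p] : 1 + p ≡ σ (p ^ 1)
    1+p≡σ[p] = trans (+-comm 1 p) (trans (cong (_+ 1) (sym (*-identityʳ p))) (sym (σ-pow-suc 0)))
  σ-odd-pow-even 2∣1+p (suc t) = subst (λ e → 2 ∣ σ (p ^ (1 + e))) (sym (*-suc 2 t)) 2∣σ
    where
    e : ℕ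
    e = 1 + 2 * t
    σ-pow-2+ : σ (p ^ (2 + e)) ≡ p * p * σ (p ^ e) + (1 + p)
    σ-pow-2+ = begin
      σ (p ^ (2 + e))                  ≡⟨ σ-pow-suc (1 + e) ⟩
      p * σ (p ^ (1 + e)) + 1          ≡⟨ cong (λ y → p * y + 1) (σ-pow-suc e) ⟩
      p * (p * σ (p ^ e) + 1) + 1      ≡⟨ expand p (σ (p ^ e)) ⟩
      p * p * σ (p ^ e) + (1 + p)      ∎
      where
      open ≡-Reasoning
      expand : ∀ a s → a * (a * s + 1) + 1 ≡ a * a * s + (1 + a)
      expand = solve-∀
    2∣σ : 2 ∣ σ (p ^ (2 + e))
    2∣σ = subst (2 ∣_) (sym σ-pow-2+) (∣m∣n⇒∣m+n (∣n⇒∣m*n (p * p) (σ-odd-pow-even 2∣1+p t)) 2∣1+p)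

  σ-pow-even : p % 4 ≡ 1 → ∀ k → k % 4 ≡ 1 → 2 ∣ σ (p ^ k)
  σ-pow-even p%4≡1 k k%4≡1 with n%4≡1⇒n≡1+2*t p p%4≡1 | n%4≡1⇒n≡1+2*t k k%4≡1
  ... | u , p≡1+2u | t , k≡1+2t =
    subst (λ e → 2 ∣ σ (p ^ e)) (sym k≡1+2t) (σ-odd-pow-even 2∣1+p t)
    where
    2∣1+p : 2 ∣ 1 + p
    2∣1+p = subst (λ y → 2 ∣ 1 + y) (sym p≡1+2u) (∣m∣n⇒∣m+n (∣-refl {2}) (m∣m*n u))

coprime-cofactor : ∀ {A B Q M w} .{{_ : NonZero Q}} →
                   A * B ≡ 2 * (Q * M) → A ≡ 2 * w → Coprime Q A →
                   ∃[ c ] B ≡ c * Q × M ≡ w * c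
coprime-cofactor {A} {B} {Q} {M} {w} AB≡2QM A≡2w Q⊥A = c , B≡cQ , M≡wc
  where
  wB≡QM : w * B ≡ Q * M
  wB≡QM = *-cancelˡ-≡ (w * B) (Q * M) 2
            (trans (sym (*-assoc 2 w B)) (trans (cong (_* B) (sym A≡2w)) AB≡2QM))
  Q⊥w : Coprime Q w
  Q⊥w (d∣Q , d∣w) = Q⊥A (d∣Q , subst (_ ∣_) (sym A≡2w) (∣n⇒∣m*n 2 d∣w))
  Q∣B : Q ∣ B
  Q∣B = coprime-divisor Q⊥w (divides M (trans wB≡QM (*-comm Q M)))
  c : ℕ
  c = quotient Q∣B
  B≡cQ : B ≡ c * Q
  B≡cQ = m∣n⇒n≡quotient*m Q∣B
  M≡wc : M ≡ w * c
  M≡wc = *-cancelʳ-≡ M (w * c) Q (begin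
    M * Q        ≡⟨ *-comm M Q ⟩
    Q * M        ≡⟨ wB≡QM ⟨
    w * B        ≡⟨ cong (w *_) B≡cQ ⟩
    w * (c * Q)  ≡⟨ *-assoc w c Q ⟨
    w * c * Q    ∎)
    where open ≡-Reasoning

gcd-*-coprimeʳ : ∀ {m Q} c → Coprime m Q → gcd m (c * Q) ≡ gcd m c
gcd-*-coprimeʳ {m} {Q} c m⊥Q = ∣-antisym
  (gcd-greatest (gcd[m,n]∣m m (c * Q))
                (coprime-divisor g⊥Q (subst (gcd m (c * Q) ∣_) (*-comm c Q) (gcd[m,n]∣n m (c * Q)))))
  (gcd-greatest (gcd[m,n]∣m m c) (∣m⇒∣m*n Q (gcd[m,n]∣n m c)))
  where
  g⊥Q : Coprime (gcd m (c * Q)) Q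
  g⊥Q (e∣g , e∣Q) = m⊥Q (∣-trans e∣g (gcd[m,n]∣m m (c * Q)) , e∣Q)

gcd-∣ʳ : ∀ {m n} → n ∣ m → gcd m n ≡ n
gcd-∣ʳ {m} {n} n∣m = ∣-antisym (gcd[m,n]∣n m n) (gcd-greatest n∣m ∣-refl)

/-cross : ∀ {x y a b} .{{_ : NonZero a}} .{{_ : NonZero b}} →
          a ∣ x → b ∣ y → x * b ≡ y * a → x / a ≡ y / b
/-cross {x} {y} {a} {b} a∣x b∣y xb≡ya = *-cancelʳ-≡ (x / a) (y / b) (a * b) {{m*n≢0 a b}} (begin
  x / a * (a * b)  ≡⟨ *-assoc (x / a) a b ⟨
  x / a * a * b    ≡⟨ cong (_* b) (m/n*n≡m a∣x) ⟩
  x * b            ≡⟨ xb≡ya ⟩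
  y * a            ≡⟨ cong (_* a) (m/n*n≡m b∣y) ⟨
  y / b * b * a    ≡⟨ *-assoc (y / b) b a ⟩
  y / b * (b * a)  ≡⟨ cong (y / b *_) (*-comm b a) ⟩
  y / b * (a * b)  ∎)
  where open ≡-Reasoning

gcd-cross : ∀ n w c → w * c ≡ n * n → c * gcd w n ≡ n * gcd n c
gcd-cross n w c wc≡nn = begin
  c * gcd w n            ≡⟨ c*gcd[m,n]≡gcd[cm,cn] c w n ⟩
  gcd (c * w) (c * n)    ≡⟨ cong₂ gcd (trans (*-comm c w) wc≡nn) (*-comm c n) ⟩
  gcd (n * n) (n * c)    ≡⟨ c*gcd[m,n]≡gcd[cm,cn] n n c ⟨
  n * gcd n c            ∎
  where open ≡-Reasoning

gcd-square-quotient : ∀ {n Q B c w} .{{_ : NonZero n}} →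
                      Coprime n Q → B ≡ c * Q → n ^ 2 ≡ w * c →
                      .{{_ : NonZero (gcd n B)}} .{{_ : NonZero (gcd w n)}} →
                      gcd (n ^ 2) B / gcd n B ≡ n / gcd w n
gcd-square-quotient {n} {Q} {B} {c} {w} n⊥Q B≡cQ n²≡wc = begin
  gcd (n ^ 2) B / gcd n B  ≡⟨ /-congˡ H≡c ⟩
  c / gcd n B              ≡⟨ /-congʳ I≡gcd[n,c] ⟩
  c / gcd n c              ≡⟨ /-cross {c} {n} (gcd[m,n]∣n n c) (gcd[m,n]∣n w n) (gcd-cross n w c wc≡nn) ⟩
  n / gcd w n              ∎
  where
  open ≡-Reasoning
  instance
    gcd[n,c]≢0 : NonZero (gcd n c)
    gcd[n,c]≢0 = ≢-nonZero (gcd[m,n]≢0 n c (inj₁ (≢-nonZero⁻¹ n)))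
  wc≡nn : w * c ≡ n * n
  wc≡nn = trans (sym n²≡wc) (cong (n *_) (*-identityʳ n))
  H≡c : gcd (n ^ 2) B ≡ c
  H≡c = begin
    gcd (n ^ 2) B        ≡⟨ cong (gcd (n ^ 2)) B≡cQ ⟩
    gcd (n ^ 2) (c * Q)  ≡⟨ gcd-*-coprimeʳ c (coprime-pow 2 n⊥Q) ⟩
    gcd (n ^ 2) c        ≡⟨ gcd-∣ʳ (divides w n²≡wc) ⟩
    c                    ∎
  I≡gcd[n,c] : gcd n B ≡ gcd n c
  I≡gcd[n,c] = trans (cong (gcd n) B≡cQ) (gcd-*-coprimeʳ c n⊥Q)

lemma3 : (N q k n : ℕ) → Prime q → NonZero k → NonZero n →
         q % 4 ≡ 1 → k % 4 ≡ 1 → gcd q n ≡ 1 →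
         N ≡ q ^ k * n ^ 2 → N % 2 ≡ 1 → σ N ≡ 2 * N →
         .{{_ : NonZero (gcd n (σ (n ^ 2)))}} →
         .{{_ : NonZero (gcd (σ (q ^ k) / 2) n)}} →
         gcd (n ^ 2) (σ (n ^ 2)) / gcd n (σ (n ^ 2))
           ≡ n / gcd (σ (q ^ k) / 2) n
lemma3 N q k n q-prime _ n≢0 q%4≡1 k%4≡1 gcd[q,n]≡1 N≡qᵏn² _ σN≡2N =
  let c , σn²≡cqᵏ , n²≡wc = coprime-cofactor {w = w} σ-split σ[qᵏ]≡2w (coprime-σ-pow q-prime k)
  in  gcd-square-quotient {c = c} {w = w} {{n≢0}} (coprime-sym qᵏ⊥n) σn²≡cqᵏ n²≡wc
  where
  instance
    qᵏ≢0 : NonZero (q ^ k)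
    qᵏ≢0 = m^n≢0 q k {{prime⇒nonZero q-prime}}
  q⊥n : Coprime q n
  q⊥n = gcd≡1⇒coprime gcd[q,n]≡1
  qᵏ⊥n : Coprime (q ^ k) n
  qᵏ⊥n = coprime-pow k q⊥n
  q∤n² : ¬ q ∣ n ^ 2
  q∤n² q∣n² = nonTrivial⇒≢1 {{prime⇒nonTrivial q-prime}}
                (coprime-sym (coprime-pow 2 (coprime-sym q⊥n)) (∣-refl , q∣n²))
  σ-split : σ (q ^ k) * σ (n ^ 2) ≡ 2 * (q ^ k * n ^ 2)
  σ-split = begin
    σ (q ^ k) * σ (n ^ 2)  ≡⟨ σ-pow-* q-prime q∤n² k ⟨
    σ (q ^ k * n ^ 2)      ≡⟨ cong σ N≡qᵏn² ⟨
    σ N                    ≡⟨ σN≡2N ⟩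
    2 * N                  ≡⟨ cong (2 *_) N≡qᵏn² ⟩
    2 * (q ^ k * n ^ 2)    ∎
    where open ≡-Reasoning
  w : ℕ
  w = σ (q ^ k) / 2
  σ[qᵏ]≡2w : σ (q ^ k) ≡ 2 * w
  σ[qᵏ]≡2w = sym (m*[n/m]≡n (σ-pow-even q-prime q%4≡1 k k%4≡1))
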